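{- For every $n\ge0$, the set $\{\mathfrak{S}_\alpha : \alpha\models n\}$ is a basis of $\mathrm{NSym}_n$.
   Context: Work over $\mathbb{Q}$. $\mathrm{NSym}$ is the free associative graded algebra on $H_1,H_2,\dots$ ($H_i$ of degree $i$, $H_0=1$, $H_{ -r}=0$ for $r>0$), $\mathrm{NSym}_n$ its degree-$n$ part; it is graded dual to $\mathrm{QSym}$ through $\langle H_{\alpha_1}\cdots H_{\alpha_k},M_\beta\rangle=\delta_{\alpha\beta}$ ($M_\beta$ monomial quasisymmetric functions), with coproduct $\Delta(H_j)=\sum_i H_i\otimes H_{j-i}$. For $F\in\mathrm{QSym}$, $F^\perp$ satisfies $\langle F^\perp(H),G\rangle=\langle H,FG\rangle$; $F_{1^i}=M_{1^i}$. Let $\mathbb{B}_m=\sum_{i\ge0}(-1)^iH_{m+i}F_{1^i}^\perp$ and $\mathfrak{S}_\alpha=\mathbb{B}_{\alpha_1}\cdots\mathbb{B}_{\alpha_m}(1)$. $\alpha\models n$ means $\alpha$ is a composition of $n$. -}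

module Defs where

open import Data.Nat as ℕ using (ℕ; zero; suc; _∸_; _<_)
open import Data.List using (List; []; _∷_; map; concatMap; filter; upTo; replicate; foldr)
open import Data.Nat.ListAction using (sum)
open import Data.List.Properties using (≡-dec)
open import Data.List.Relation.Unary.All using (All)
open import Data.Product using (_×_; _,_)
open import Data.Rational using (ℚ; 0ℚ; 1ℚ; _+_; _*_; -_)
open import Relation.Nullary using (Dec; ¬_; ¬?)
open import Relation.Nullary.Decidable using (does)
open import Relation.Binary.PropositionalEquality using (_≡_)
open import Data.Bool using (if_then_else_)

-- A word w = (w₁,…,wₖ) stands for the product H_{w₁}⋯H_{wₖ} in NSym.
Word : Set
Word = List ℕ

-- H₀ = 1: delete the zero letters.
normalize : Word → Word
normalize = filter (λ k → ¬? (k ℕ.≟ 0))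

-- An element of NSym: a finite formal ℚ-linear combination of words.
NSym : Set
NSym = List (ℚ × Word)

_≟w_ : (u v : Word) → Dec (u ≡ v)
_≟w_ = ≡-dec ℕ._≟_

coeff : NSym → Word → ℚ
coeff [] β = 0ℚ
coeff ((c , w) ∷ x) β =
  (if does (normalize w ≟w β) then c else 0ℚ) + coeff x β

-- Coproduct on words: Δ(H_{w₁}⋯H_{wₖ}) = ∏ⱼ Σ_{i≤wⱼ} H_i ⊗ H_{wⱼ-i}.
Δword : Word → List (Word × Word)
Δword [] = ([] , []) ∷ []
Δword (j ∷ w) =
  concatMap (λ i → map (λ { (u , v) → (i ∷ u , (j ∸ i) ∷ v) }) (Δword w))
            (upTo (suc j))

-- Pairing ⟨H_u , M_{1^i}⟩ (= ⟨H_u , F_{1^i}⟩) is 1 if normalize u = 1^i, else 0.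
pair1 : ℕ → Word → ℚ
pair1 i u = if does (normalize u ≟w replicate i 1) then 1ℚ else 0ℚ

-- F_{1^i}^⊥ h = Σ ⟨h₍₁₎ , F_{1^i}⟩ h₍₂₎  (adjoint of multiplication by F_{1^i}).
perp : ℕ → NSym → NSym
perp i = concatMap (λ { (c , w) →
  map (λ { (u , v) → (c * pair1 i u , v) }) (Δword w) })

scale : ℚ → NSym → NSym
scale a = map (λ { (c , w) → (a * c , w) })

mulH : ℕ → NSym → NSym
mulH k = map (λ { (c , w) → (c , k ∷ w) })

sign : ℕ → ℚ
sign zero = 1ℚ
sign (suc i) = - sign i

-- total size; F_{1^i}^⊥ x = 0 whenever i exceeds the degree of every term,
-- so truncating the (formally infinite) sum at this bound is exact.
bound : NSym → ℕ
bound x = sum (map (λ { (c , w) → sum w }) x)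

𝔹 : ℕ → NSym → NSym
𝔹 m x = concatMap (λ i → scale (sign i) (mulH (m ℕ.+ i) (perp i x)))
                  (upTo (suc (bound x)))

one : NSym
one = (1ℚ , []) ∷ []

𝔖 : List ℕ → NSym
𝔖 α = foldr 𝔹 one α

IsComp : ℕ → List ℕ → Set
IsComp n α = All (λ k → 0 < k) α × sum α ≡ n

-- enumeration of all compositions of n (fuel-bounded; fuel n suffices)
compsF : ℕ → ℕ → List (List ℕ)
compsF _ zero = [] ∷ []
compsF zero (suc n) = []
compsF (suc f) (suc n) =
  concatMap (λ k → map (suc k ∷_) (compsF f (n ∸ k))) (upTo (suc n))

comps : ℕ → List (List ℕ)
comps n = compsF n n

lincomb : ℕ → (List ℕ → ℚ) → NSym
lincomb n c = concatMap (λ α → scale (c α) (𝔖 α)) (comps n)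

Homogeneous : ℕ → NSym → Set
Homogeneous n x = ∀ β → ¬ (sum β ≡ n) → coeff x β ≡ 0ℚ

-- In 𝔹_m x = Σ_i (-1)^i H_{m+i} F_{1^i}^⊥ x the summand i = 0 is H_m x, while for i > 0 every
-- word starts with the letter m + i > m; all summands have degree m + deg x. By induction on α,
-- 𝔖_α = H_α + (a combination of H_β with |β| = |α| and β lexicographically above α). So the
-- compositions of n, listed in lexicographic order, index a unitriangular family in the basis
-- {H_β}, which is independent and spanning over any ring.

module Submission where

open import Defs
open import Level using (_⊔_)
open import Function using (id; _∘_)
open import Data.Nat as ℕ using (ℕ; zero; suc; _∸_; _<_; _≤_; s≤s; z<s; s<s; s≤s⁻¹; s<s⁻¹)
import Data.Nat.Properties as ℕₚ
open import Data.Nat.ListAction using (sum)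
open import Data.List using (List; []; _∷_; map; concatMap; _++_; applyUpTo; upTo; replicate)
open import Data.List.Properties using (∷-injective; map-++)
open import Data.List.Relation.Unary.All as All using (All; []; _∷_)
import Data.List.Relation.Unary.All.Properties as Allₚ
open import Data.List.Relation.Unary.AllPairs as AllPairs using (AllPairs; []; _∷_)
import Data.List.Relation.Unary.AllPairs.Properties as AllPairsₚ
open import Data.List.Relation.Unary.Any using (here; there)
open import Data.List.Membership.Propositional using (_∈_; lose)
open import Data.List.Membership.Propositional.Properties using (∈-concatMap⁺; ∈-map⁺; ∈-upTo⁺)
open import Data.List.Relation.Binary.Pointwise using (≡⇒Pointwise-≡)
open import Data.List.Relation.Binary.Lex.Strict using (Lex-<; this; next; <-irreflexive)
open import Data.Product using (_×_; _,_; Σ; proj₁; proj₂)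
open import Data.Sum using (_⊎_; inj₁; inj₂; [_,_]′; map₂)
open import Algebra.Bundles using (Ring)
open import Relation.Nullary using (¬_; yes; no; does; contradiction)
open import Relation.Binary.Definitions using (DecidableEquality)
import Relation.Binary.PropositionalEquality as ≡

module UnitriangularFamily {ℓ₁ ℓ₂ ℓ₃} (R : Ring ℓ₁ ℓ₂) {A : Set ℓ₃} (_≟_ : DecidableEquality A)
                           (_≺_ : A → A → Set ℓ₃) (≺-irrefl : ∀ {a} → ¬ a ≺ a)
                           (v : A → A → Ring.Carrier R) where

  open Ring R
  open import Algebra.Properties.AbelianGroup +-abelianGroup using (xyx⁻¹≈y)
  open import Relation.Binary.Reasoning.Setoid setoid

  combination : List A → (A → Carrier) → A → Carrier
  combination []      c β = 0#
  combination (a ∷ L) c β = c a * v a β + combination L c β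

  UnitriangularAt : A → Set (ℓ₂ ⊔ ℓ₃)
  UnitriangularAt a = v a a ≈ 1# × (∀ β → β ≺ a → v a β ≈ 0#)

  SupportedIn : List A → (A → Carrier) → Set (ℓ₂ ⊔ ℓ₃)
  SupportedIn L f = ∀ β → f β ≈ 0# ⊎ β ∈ L

  supportedIn-tail : ∀ {a L f} → f a ≈ 0# → SupportedIn (a ∷ L) f → SupportedIn L f
  supportedIn-tail fa≈0 supp β with supp β
  ... | inj₁ fβ≈0          = inj₁ fβ≈0
  ... | inj₂ (here ≡.refl) = inj₁ fa≈0
  ... | inj₂ (there β∈L)   = inj₂ β∈L

  combination-zero : ∀ L c β → All (λ a → v a β ≈ 0#) L → combination L c β ≈ 0#
  combination-zero []      c β []       = refl
  combination-zero (a ∷ L) c β (z ∷ zs) = begin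
    c a * v a β + combination L c β ≈⟨ +-cong (trans (*-congˡ z) (zeroʳ (c a))) (combination-zero L c β zs) ⟩
    0# + 0#                         ≈⟨ +-identityˡ 0# ⟩
    0#                              ∎

  combination-cong : ∀ L {c c′} β → All (λ a → c a ≈ c′ a) L → combination L c β ≈ combination L c′ β
  combination-cong []      β []       = refl
  combination-cong (a ∷ L) β (e ∷ es) = +-cong (*-congʳ e) (combination-cong L β es)

  combination-independent : ∀ {L} → AllPairs _≺_ L → All UnitriangularAt L →
                            ∀ c → (∀ β → combination L c β ≈ 0#) → All (λ a → c a ≈ 0#) L
  combination-independent [] [] c vanishes = []
  combination-independent {a ∷ L} (a≺L ∷ sorted) ((vaa≈1 , _) ∷ unitri) c vanishes =
    ca≈0 ∷ combination-independent sorted unitri c tail-vanishes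
    where
    ca≈0 : c a ≈ 0#
    ca≈0 = begin
      c a                             ≈⟨ *-identityʳ (c a) ⟨
      c a * 1#                        ≈⟨ *-congˡ vaa≈1 ⟨
      c a * v a a                     ≈⟨ +-identityʳ _ ⟨
      c a * v a a + 0#                ≈⟨ +-congˡ (combination-zero L c a
                                            (All.zipWith (λ (a≺b , (_ , below)) → below a a≺b) (a≺L , unitri))) ⟨
      c a * v a a + combination L c a ≈⟨ vanishes a ⟩
      0#                              ∎
    tail-vanishes : ∀ β → combination L c β ≈ 0#
    tail-vanishes β = begin
      combination L c β               ≈⟨ +-identityˡ _ ⟨
      0# + combination L c β          ≈⟨ +-congʳ (trans (*-congʳ ca≈0) (zeroˡ (v a β))) ⟨
      c a * v a β + combination L c β ≈⟨ vanishes β ⟩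
      0#                              ∎

  -- Peel off the leading index a: its coefficient must be x a, and the remainder x - x a · v a is supported on L.
  combination-spanning : ∀ {L} → AllPairs _≺_ L → All (λ a → UnitriangularAt a × SupportedIn L (v a)) L →
                         ∀ x → SupportedIn L x → Σ (A → Carrier) λ c → ∀ β → combination L c β ≈ x β
  combination-spanning [] [] x supp = (λ _ → 0#) , λ β → [ sym , (λ ()) ]′ (supp β)
  combination-spanning {a ∷ L} (a≺L ∷ sorted) (((vaa≈1 , _) , va-supp) ∷ family) x x-supp = c , spans
    where
    y : A → Carrier
    y β = x β - x a * v a β

    ya≈0 : y a ≈ 0#
    ya≈0 = begin
      x a - x a * v a a ≈⟨ +-congˡ (-‿cong (trans (*-congˡ vaa≈1) (*-identityʳ (x a)))) ⟩
      x a - x a         ≈⟨ -‿inverseʳ (x a) ⟩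
      0#                ∎

    y-supp : SupportedIn L y
    y-supp = supportedIn-tail ya≈0 λ β → combine (x-supp β) (va-supp β)
      where
      combine : ∀ {β} → x β ≈ 0# ⊎ β ∈ a ∷ L → v a β ≈ 0# ⊎ β ∈ a ∷ L → y β ≈ 0# ⊎ β ∈ a ∷ L
      combine (inj₂ β∈) _         = inj₂ β∈
      combine (inj₁ _)  (inj₂ β∈) = inj₂ β∈
      combine {β} (inj₁ xβ≈0) (inj₁ vaβ≈0) = inj₁ (begin
        x β - x a * v a β ≈⟨ +-cong xβ≈0 (-‿cong (trans (*-congˡ vaβ≈0) (zeroʳ (x a)))) ⟩
        0# - 0#           ≈⟨ -‿inverseʳ 0# ⟩
        0#                ∎)

    family-tail : All (λ b → UnitriangularAt b × SupportedIn L (v b)) L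
    family-tail = All.zipWith (λ (a≺b , (unitri , supp)) → unitri , supportedIn-tail (proj₂ unitri a a≺b) supp)
                              (a≺L , family)

    rest : Σ (A → Carrier) λ c′ → ∀ β → combination L c′ β ≈ y β
    rest = combination-spanning sorted family-tail y y-supp

    c : A → Carrier
    c b with b ≟ a
    ... | yes _ = x a
    ... | no  _ = proj₁ rest b

    c-head : c a ≈ x a
    c-head with a ≟ a
    ... | yes _   = refl
    ... | no  a≢a = contradiction ≡.refl a≢a

    c-tail : All (λ b → c b ≈ proj₁ rest b) L
    c-tail = All.map tail-eq a≺L
      where
      tail-eq : ∀ {b} → a ≺ b → c b ≈ proj₁ rest b
      tail-eq {b} a≺b with b ≟ a
      ... | yes ≡.refl = contradiction a≺b ≺-irrefl
      ... | no  _      = refl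

    spans : ∀ β → combination (a ∷ L) c β ≈ x β
    spans β = begin
      c a * v a β + combination L c β             ≈⟨ +-cong (*-congʳ c-head) (combination-cong L β c-tail) ⟩
      x a * v a β + combination L (proj₁ rest) β  ≈⟨ +-congˡ (proj₂ rest β) ⟩
      x a * v a β + (x β - x a * v a β)           ≈⟨ +-assoc _ _ _ ⟨
      x a * v a β + x β - x a * v a β             ≈⟨ xyx⁻¹≈y (x a * v a β) (x β) ⟩
      x β                                         ∎

-- Imported only after the generic module, where these names would clash with those of the ring.
open import Data.Rational using (ℚ; 0ℚ; 1ℚ; _+_; _*_)
import Data.Rational.Properties as ℚₚ
open import Data.Bool using (true; false; if_then_else_)
open import Algebra.Properties.CommutativeSemigroup ℕₚ.+-commutativeSemigroup using (interchange)
open import Relation.Nullary.Decidable using (dec-true; dec-false)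
open import Relation.Binary.PropositionalEquality
  using (_≡_; _≢_; _≗_; refl; sym; trans; cong; cong₂; subst; module ≡-Reasoning)

-- Equality in NSym: a list of terms is a formal sum, so only its coefficients matter.
infix 4 _≃_
record _≃_ (x y : NSym) : Set where
  constructor coeffwise
  field coeff-≡ : coeff x ≗ coeff y
open _≃_

coeff-++ : ∀ x y β → coeff (x ++ y) β ≡ coeff x β + coeff y β
coeff-++ [] y β = sym (ℚₚ.+-identityˡ _)
coeff-++ ((c , w) ∷ x) y β =
  trans (cong (t +_) (coeff-++ x y β)) (sym (ℚₚ.+-assoc t (coeff x β) (coeff y β)))
  where t = if does (normalize w ≟w β) then c else 0ℚ

++-cong : ∀ {x x′ y y′} → x ≃ x′ → y ≃ y′ → x ++ y ≃ x′ ++ y′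
++-cong {x} {x′} {y} {y′} x≃x′ y≃y′ = coeffwise λ β → begin
  coeff (x ++ y) β          ≡⟨ coeff-++ x y β ⟩
  coeff x β + coeff y β     ≡⟨ cong₂ _+_ (coeff-≡ x≃x′ β) (coeff-≡ y≃y′ β) ⟩
  coeff x′ β + coeff y′ β   ≡⟨ coeff-++ x′ y′ β ⟨
  coeff (x′ ++ y′) β        ∎
  where open ≡-Reasoning

coeff-scale : ∀ a x β → coeff (scale a x) β ≡ a * coeff x β
coeff-scale a [] β = sym (ℚₚ.*-zeroʳ a)
coeff-scale a ((c , w) ∷ x) β =
  trans (cong₂ _+_ (ite-* (does (normalize w ≟w β))) (coeff-scale a x β)) (sym (ℚₚ.*-distribˡ-+ a _ _))
  where
  ite-* : ∀ b → (if b then a * c else 0ℚ) ≡ a * (if b then c else 0ℚ)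
  ite-* true  = refl
  ite-* false = sym (ℚₚ.*-zeroʳ a)

coeff-∷-≢ : ∀ c w x {β} → normalize w ≢ β → coeff ((c , w) ∷ x) β ≡ coeff x β
coeff-∷-≢ c w x {β} w≢β rewrite dec-false (normalize w ≟w β) w≢β = ℚₚ.+-identityˡ (coeff x β)

+-zero-or : ∀ {P : Set} {a b} → a ≡ 0ℚ ⊎ P → b ≡ 0ℚ ⊎ P → a + b ≡ 0ℚ ⊎ P
+-zero-or (inj₁ refl) (inj₁ refl) = inj₁ (ℚₚ.+-identityˡ 0ℚ)
+-zero-or (inj₂ p)    _           = inj₂ p
+-zero-or _           (inj₂ p)    = inj₂ p

coeff-support : ∀ {P : Word → Set} x → All (λ t → proj₁ t ≡ 0ℚ ⊎ P (normalize (proj₂ t))) x →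
                ∀ β → coeff x β ≡ 0ℚ ⊎ P β
coeff-support [] [] β = inj₁ refl
coeff-support {P} ((c , w) ∷ x) (t ∷ ts) β with normalize w ≟w β
... | yes refl = +-zero-or {P β} t (coeff-support {P} x ts β)
... | no  _    = +-zero-or {P β} (inj₁ refl) (coeff-support {P} x ts β)

coeff-zero : ∀ {β} x → All (λ t → proj₁ t ≡ 0ℚ ⊎ normalize (proj₂ t) ≢ β) x → coeff x β ≡ 0ℚ
coeff-zero {β} x zs = [ id , (λ β≢β → contradiction refl β≢β) ]′ (coeff-support {P = _≢ β} x zs β)

does-∷-≟ : ∀ k u γ → does ((k ∷ u) ≟w (k ∷ γ)) ≡ does (u ≟w γ)
does-∷-≟ k u γ rewrite dec-true (k ℕ.≟ k) refl = refl

coeff-mulH-zero : ∀ x β → coeff (mulH 0 x) β ≡ coeff x β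
coeff-mulH-zero [] β = refl
coeff-mulH-zero ((c , w) ∷ x) β = cong (t +_) (coeff-mulH-zero x β)
  where t = if does (normalize w ≟w β) then c else 0ℚ

coeff-mulH-∷ : ∀ k x γ → coeff (mulH (suc k) x) (suc k ∷ γ) ≡ coeff x γ
coeff-mulH-∷ k [] γ = refl
coeff-mulH-∷ k ((c , w) ∷ x) γ =
  cong₂ _+_ (cong (λ b → if b then c else 0ℚ) (does-∷-≟ (suc k) (normalize w) γ)) (coeff-mulH-∷ k x γ)

coeff-mulH-≢ : ∀ k x {β} → (∀ γ → β ≢ suc k ∷ γ) → coeff (mulH (suc k) x) β ≡ 0ℚ
coeff-mulH-≢ k [] _ = refl
coeff-mulH-≢ k ((c , w) ∷ x) β≢ =
  trans (coeff-∷-≢ c (suc k ∷ w) (mulH (suc k) x) (λ e → β≢ _ (sym e))) (coeff-mulH-≢ k x β≢)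

mulH-cong : ∀ k {x y} → x ≃ y → mulH k x ≃ mulH k y
mulH-cong k {x} {y} x≃y = coeffwise (pointwise k)
  where
  pointwise : ∀ k β → coeff (mulH k x) β ≡ coeff (mulH k y) β
  pointwise zero β = trans (coeff-mulH-zero x β) (trans (coeff-≡ x≃y β) (sym (coeff-mulH-zero y β)))
  pointwise (suc k) [] = trans (coeff-mulH-≢ k x λ _ ()) (sym (coeff-mulH-≢ k y λ _ ()))
  pointwise (suc k) (b ∷ γ) with b ℕ.≟ suc k
  ... | yes refl = trans (coeff-mulH-∷ k x γ) (trans (coeff-≡ x≃y γ) (sym (coeff-mulH-∷ k y γ)))
  ... | no  b≢1+k = trans (coeff-mulH-≢ k x b∷γ≢) (sym (coeff-mulH-≢ k y b∷γ≢))
    where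
    b∷γ≢ : ∀ γ′ → b ∷ γ ≢ suc k ∷ γ′
    b∷γ≢ _ e = b≢1+k (proj₁ (∷-injective e))

perpTerm : ℕ → ℚ → Word × Word → ℚ × Word
perpTerm i c (u , v) = (c * pair1 i u , v)

perp-zero-term : ∀ c w → map (perpTerm 0 c) (Δword w) ≃ (c , w) ∷ []
perp-zero-term c [] = coeffwise λ β → cong (λ d → coeff ((d , []) ∷ []) β) (ℚₚ.*-identityʳ c)
perp-zero-term c (j ∷ w) = coeffwise λ β → begin
  coeff (map (perpTerm 0 c) (map first (Δword w) ++ rest)) β
    ≡⟨ cong (λ z → coeff z β) (map-++ (perpTerm 0 c) (map first (Δword w)) rest) ⟩
  coeff (map (perpTerm 0 c) (map first (Δword w)) ++ map (perpTerm 0 c) rest) β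
    ≡⟨ cong (λ z → coeff (z ++ map (perpTerm 0 c) rest) β) (first-block (Δword w)) ⟩
  coeff (mulH j (map (perpTerm 0 c) (Δword w)) ++ map (perpTerm 0 c) rest) β
    ≡⟨ coeff-≡ (++-cong (mulH-cong j (perp-zero-term c w)) rest≃0) β ⟩
  coeff ((c , j ∷ w) ∷ []) β ∎
  where
  open ≡-Reasoning
  first : Word × Word → Word × Word
  first (u , v) = (0 ∷ u , j ∷ v)
  first-block : ∀ ps → map (perpTerm 0 c) (map first ps) ≡ mulH j (map (perpTerm 0 c) ps)
  first-block [] = refl
  first-block (_ ∷ ps) = cong (_ ∷_) (first-block ps)
  rest : List (Word × Word)
  rest = concatMap (λ i → map (λ { (u , v) → (i ∷ u , j ∸ i ∷ v) }) (Δword w)) (applyUpTo suc j)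
  -- A first tensor factor with a positive letter pairs to zero with F_{1^0} = 1.
  rest≃0 : map (perpTerm 0 c) rest ≃ []
  rest≃0 = coeffwise λ _ → coeff-zero (map (perpTerm 0 c) rest)
    (Allₚ.map⁺ (Allₚ.concat⁺ (Allₚ.map⁺ (Allₚ.applyUpTo⁺₂ suc j λ _ →
      Allₚ.map⁺ (All.universal (λ _ → inj₁ (ℚₚ.*-zeroʳ c)) (Δword w))))))

perp-zero : ∀ x → perp 0 x ≃ x
perp-zero [] = coeffwise λ _ → refl
perp-zero ((c , w) ∷ x) = ++-cong (perp-zero-term c w) (perp-zero x)

coeff-𝔹-leading : ∀ m x γ → coeff (𝔹 (suc m) x) (suc m ∷ γ) ≡ coeff x γ
coeff-𝔹-leading m x γ = begin
  coeff (𝔹 (suc m) x) (suc m ∷ γ)                       ≡⟨ coeff-++ (term 0) higher (suc m ∷ γ) ⟩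
  coeff (term 0) (suc m ∷ γ) + coeff higher (suc m ∷ γ) ≡⟨ cong₂ _+_ leading (coeff-zero higher higher-miss) ⟩
  coeff x γ + 0ℚ                                        ≡⟨ ℚₚ.+-identityʳ _ ⟩
  coeff x γ                                             ∎
  where
  open ≡-Reasoning
  term : ℕ → NSym
  term i = scale (sign i) (mulH (suc m ℕ.+ i) (perp i x))
  higher : NSym
  higher = concatMap term (applyUpTo suc (bound x))
  leading : coeff (term 0) (suc m ∷ γ) ≡ coeff x γ
  leading = begin
    coeff (term 0) (suc m ∷ γ)
      ≡⟨ coeff-scale 1ℚ (mulH (suc m ℕ.+ 0) (perp 0 x)) (suc m ∷ γ) ⟩
    1ℚ * coeff (mulH (suc m ℕ.+ 0) (perp 0 x)) (suc m ∷ γ)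
      ≡⟨ ℚₚ.*-identityˡ _ ⟩
    coeff (mulH (suc m ℕ.+ 0) (perp 0 x)) (suc m ∷ γ)
      ≡⟨ cong (λ k → coeff (mulH (suc k) (perp 0 x)) (suc m ∷ γ)) (ℕₚ.+-identityʳ m) ⟩
    coeff (mulH (suc m) (perp 0 x)) (suc m ∷ γ)
      ≡⟨ coeff-mulH-∷ m (perp 0 x) γ ⟩
    coeff (perp 0 x) γ
      ≡⟨ coeff-≡ (perp-zero x) γ ⟩
    coeff x γ ∎
  higher-miss : All (λ t → proj₁ t ≡ 0ℚ ⊎ normalize (proj₂ t) ≢ suc m ∷ γ) higher
  higher-miss = Allₚ.concat⁺ (Allₚ.map⁺ (Allₚ.applyUpTo⁺₂ suc (bound x) λ i →
    Allₚ.map⁺ (Allₚ.map⁺ (All.universal (λ _ → inj₂ λ e →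
      ℕₚ.m+1+n≢m m (ℕₚ.suc-injective (proj₁ (∷-injective e)))) (perp (suc i) x)))))

coeff-𝔖-diagonal : ∀ α → All (0 <_) α → coeff (𝔖 α) α ≡ 1ℚ
coeff-𝔖-diagonal []          []        = ℚₚ.+-identityʳ 1ℚ
coeff-𝔖-diagonal (suc m ∷ α) (_ ∷ α>0) = trans (coeff-𝔹-leading m (𝔖 α) α) (coeff-𝔖-diagonal α α>0)

All-scale : ∀ {P : ℚ × Word → Set} a {x} → All (λ t → P (a * proj₁ t , proj₂ t)) x → All P (scale a x)
All-scale a = Allₚ.map⁺ {f = λ t → (a * proj₁ t , proj₂ t)}

All-mulH : ∀ {P : ℚ × Word → Set} k {x} → All (λ t → P (proj₁ t , k ∷ proj₂ t)) x → All P (mulH k x)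
All-mulH k = Allₚ.map⁺ {f = λ t → (proj₁ t , k ∷ proj₂ t)}

infix 4 _<ₗ_
_<ₗ_ : Word → Word → Set
_<ₗ_ = Lex-< _≡_ _<_

<ₗ-irrefl : ∀ {u} → ¬ u <ₗ u
<ₗ-irrefl = <-irreflexive ℕₚ.<-irrefl (≡⇒Pointwise-≡ refl)

sum-normalize : ∀ w → sum (normalize w) ≡ sum w
sum-normalize []          = refl
sum-normalize (zero ∷ w)  = sum-normalize w
sum-normalize (suc k ∷ w) = cong (suc k ℕ.+_) (sum-normalize w)

normalize-positive : ∀ w → All (0 <_) (normalize w)
normalize-positive []          = []
normalize-positive (zero ∷ w)  = normalize-positive w
normalize-positive (suc k ∷ w) = z<s ∷ normalize-positive w

sum-replicate-1 : ∀ i → sum (replicate i 1) ≡ i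
sum-replicate-1 zero    = refl
sum-replicate-1 (suc i) = cong suc (sum-replicate-1 i)

IsSplit : Word → Word × Word → Set
IsSplit w (u , v) = sum u ℕ.+ sum v ≡ sum w × (normalize u ≡ [] → v ≡ w)

Δword-split : ∀ w → All (IsSplit w) (Δword w)
Δword-split []      = (refl , λ _ → refl) ∷ []
Δword-split (j ∷ w) = Allₚ.concat⁺ (Allₚ.map⁺ (Allₚ.applyUpTo⁺₁ id (suc j) λ i<1+j →
  Allₚ.map⁺ (All.map (split-∷ (s≤s⁻¹ i<1+j)) (Δword-split w))))
  where
  split-∷ : ∀ {i u v} → i ≤ j → IsSplit w (u , v) → IsSplit (j ∷ w) (i ∷ u , j ∸ i ∷ v)
  split-∷ {i} {u} {v} i≤j (|u|+|v|≡|w| , u≈∅⇒v≡w) =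
    trans (interchange i (sum u) (j ∸ i) (sum v)) (cong₂ ℕ._+_ (ℕₚ.m+[n∸m]≡n i≤j) |u|+|v|≡|w|) ,
    head-zero i
    where
    head-zero : ∀ i → normalize (i ∷ u) ≡ [] → j ∸ i ∷ v ≡ j ∷ w
    head-zero zero    u≈∅ = cong (j ∷_) (u≈∅⇒v≡w u≈∅)
    head-zero (suc i) ()

Above : Word → ℚ × Word → Set
Above α (c , w) = c ≡ 0ℚ ⊎ (sum w ≡ sum α × ¬ normalize w <ₗ α)

AboveAfterPerp : ℕ → Word → ℚ × Word → Set
AboveAfterPerp i α (c , v) = c ≡ 0ℚ ⊎ (i ℕ.+ sum v ≡ sum α × (i ≡ 0 → ¬ normalize v <ₗ α))

perpTerm-above : ∀ i {α c w} → Above α (c , w) → ∀ p → IsSplit w p → AboveAfterPerp i α (perpTerm i c p)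
perpTerm-above i (inj₁ refl) (u , v) _ = inj₁ (ℚₚ.*-zeroˡ (pair1 i u))
perpTerm-above i {α} {c} (inj₂ (|w|≡|α| , w≮α)) (u , v) (|u|+|v|≡|w| , u≈∅⇒v≡w) with normalize u ≟w replicate i 1
... | no  _     = inj₁ (ℚₚ.*-zeroʳ c)
... | yes u≈1ⁱ = inj₂ (size , λ { refl → subst (λ z → ¬ normalize z <ₗ α) (sym (u≈∅⇒v≡w u≈1ⁱ)) w≮α })
  where
  size : i ℕ.+ sum v ≡ sum α
  size = begin
    i ℕ.+ sum v                   ≡⟨ cong (ℕ._+ sum v) (sum-replicate-1 i) ⟨
    sum (replicate i 1) ℕ.+ sum v ≡⟨ cong (λ z → sum z ℕ.+ sum v) u≈1ⁱ ⟨
    sum (normalize u) ℕ.+ sum v   ≡⟨ cong (ℕ._+ sum v) (sum-normalize u) ⟩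
    sum u ℕ.+ sum v               ≡⟨ trans |u|+|v|≡|w| |w|≡|α| ⟩
    sum α                         ∎
    where open ≡-Reasoning

perp-above : ∀ i {α} x → All (Above α) x → All (AboveAfterPerp i α) (perp i x)
perp-above i []            []       = []
perp-above i ((c , w) ∷ x) (t ∷ ts) =
  Allₚ.++⁺ (Allₚ.map⁺ (All.map (λ {p} → perpTerm-above i t p) (Δword-split w))) (perp-above i x ts)

𝔹-above : ∀ m {α} x → All (Above α) x → All (Above (suc m ∷ α)) (𝔹 (suc m) x)
𝔹-above m {α} x ts = Allₚ.concat⁺ (Allₚ.map⁺ (All.universal (λ i →
  All-scale (sign i) (All-mulH (suc m ℕ.+ i) (All.map (λ {t} → shift i t) (perp-above i x ts))))
  (upTo (suc (bound x)))))
  where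
  shift : ∀ i t → AboveAfterPerp i α t → Above (suc m ∷ α) (sign i * proj₁ t , suc m ℕ.+ i ∷ proj₂ t)
  shift i (_ , v) (inj₁ refl) = inj₁ (ℚₚ.*-zeroʳ (sign i))
  shift i (_ , v) (inj₂ (i+|v|≡|α| , v≮α)) =
    inj₂ (cong suc (trans (ℕₚ.+-assoc m i (sum v)) (cong (m ℕ.+_) i+|v|≡|α|)) , ≮ i v≮α)
    where
    ≮ : ∀ i → (i ≡ 0 → ¬ normalize v <ₗ α) → ¬ suc (m ℕ.+ i) ∷ normalize v <ₗ suc m ∷ α
    ≮ i       _    (this m+i<m)  = ℕₚ.m+n≮m m i (s<s⁻¹ m+i<m)
    ≮ zero    v≮α (next _ v<α)  = v≮α refl v<α
    ≮ (suc i) _    (next m+1+i≡m _) = ℕₚ.m+1+n≢m m (ℕₚ.suc-injective m+1+i≡m)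

𝔖-above : ∀ α → All (0 <_) α → All (Above α) (𝔖 α)
𝔖-above []          []        = inj₂ (refl , <ₗ-irrefl) ∷ []
𝔖-above (suc m ∷ α) (_ ∷ α>0) = 𝔹-above m (𝔖 α) (𝔖-above α α>0)

coeff-𝔖-support : ∀ α → All (0 <_) α → ∀ β → coeff (𝔖 α) β ≡ 0ℚ ⊎ (IsComp (sum α) β × ¬ β <ₗ α)
coeff-𝔖-support α α>0 = coeff-support (𝔖 α) (All.map (λ {t} → weaken t) (𝔖-above α α>0))
  where
  weaken : ∀ t → Above α t → proj₁ t ≡ 0ℚ ⊎ (IsComp (sum α) (normalize (proj₂ t)) × ¬ normalize (proj₂ t) <ₗ α)
  weaken _ (inj₁ c≡0) = inj₁ c≡0
  weaken (_ , w) (inj₂ (|w|≡|α| , w≮α)) = inj₂ ((normalize-positive w , trans (sum-normalize w) |w|≡|α|) , w≮α)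

compsF-sound : ∀ f m → All (IsComp m) (compsF f m)
compsF-sound _       zero    = ([] , refl) ∷ []
compsF-sound zero    (suc n) = []
compsF-sound (suc f) (suc n) = Allₚ.concat⁺ (Allₚ.map⁺ (Allₚ.applyUpTo⁺₁ id (suc n) λ {k} k<1+n →
  Allₚ.map⁺ (All.map (extend (s≤s⁻¹ k<1+n)) (compsF-sound f (n ∸ k)))))
  where
  extend : ∀ {k β} → k ≤ n → IsComp (n ∸ k) β → IsComp (suc n) (suc k ∷ β)
  extend {k} k≤n (β>0 , |β|≡n-k) = z<s ∷ β>0 , cong suc (trans (cong (k ℕ.+_) |β|≡n-k) (ℕₚ.m+[n∸m]≡n k≤n))

compsF-complete : ∀ f {m β} → IsComp m β → m ≤ f → β ∈ compsF f m
compsF-complete _       {β = zero ∷ _}        (() ∷ _ , _)          _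
compsF-complete _       {zero}  {[]}          _                     _         = here refl
compsF-complete _       {zero}  {suc _ ∷ _}   (_ , ())              _
compsF-complete zero    {suc n}               _                     ()
compsF-complete (suc f) {suc n} {suc k ∷ β}   (_ ∷ β>0 , |kβ|≡1+n) (s≤s n≤f) =
  ∈-concatMap⁺ (λ k → map (suc k ∷_) (compsF f (n ∸ k))) (lose (∈-upTo⁺ (s≤s k≤n))
    (∈-map⁺ (suc k ∷_) (compsF-complete f (β>0 , |β|≡n-k) (ℕₚ.≤-trans (ℕₚ.m∸n≤m n k) n≤f))))
  where
  k+|β|≡n : k ℕ.+ sum β ≡ n
  k+|β|≡n = ℕₚ.suc-injective |kβ|≡1+n
  |β|≡n-k : sum β ≡ n ∸ k
  |β|≡n-k = trans (sym (ℕₚ.m+n∸m≡n k (sum β))) (cong (_∸ k) k+|β|≡n)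
  k≤n : k ≤ n
  k≤n = subst (k ≤_) k+|β|≡n (ℕₚ.m≤m+n k (sum β))

compsF-sorted : ∀ f m → AllPairs _<ₗ_ (compsF f m)
compsF-sorted _       zero    = [] ∷ []
compsF-sorted zero    (suc n) = []
compsF-sorted (suc f) (suc n) = AllPairsₚ.concat⁺
  (Allₚ.map⁺ (All.universal (λ k → AllPairsₚ.map⁺ (AllPairs.map (next refl) (compsF-sorted f (n ∸ k)))) (upTo (suc n))))
  (AllPairsₚ.map⁺ (AllPairsₚ.applyUpTo⁺₁ id (suc n) λ k<k′ _ →
    Allₚ.map⁺ (All.universal (λ _ → Allₚ.map⁺ (All.universal (λ _ → this (s<s k<k′)) _)) _)))

comps-complete : ∀ {n β} → IsComp n β → β ∈ comps n
comps-complete {n} β⊨n = compsF-complete n β⊨n ℕₚ.≤-refl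

open UnitriangularFamily ℚₚ.+-*-ring _≟w_ _<ₗ_ <ₗ-irrefl (λ α → coeff (𝔖 α))

coeff-lincomb : ∀ L c β → coeff (concatMap (λ α → scale (c α) (𝔖 α)) L) β ≡ combination L c β
coeff-lincomb []      c β = refl
coeff-lincomb (α ∷ L) c β =
  trans (coeff-++ (scale (c α) (𝔖 α)) _ β) (cong₂ _+_ (coeff-scale (c α) (𝔖 α) β) (coeff-lincomb L c β))

homogeneous-support : ∀ {n} x → Homogeneous n x → SupportedIn (comps n) (coeff x)
homogeneous-support {n} x hom β with coeff-support x (All.universal (λ t → inj₂ (normalize-positive (proj₂ t))) x) β
... | inj₁ xβ≡0 = inj₁ xβ≡0
... | inj₂ β>0 with sum β ℕ.≟ n
...   | yes |β|≡n = inj₂ (comps-complete (β>0 , |β|≡n))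
...   | no  |β|≢n = inj₁ (hom β |β|≢n)

𝔖-unitriangular : ∀ {n α} → IsComp n α → UnitriangularAt α × SupportedIn (comps n) (coeff (𝔖 α))
𝔖-unitriangular {α = α} (α>0 , refl) =
  (coeff-𝔖-diagonal α α>0 , below) , λ β → map₂ (comps-complete ∘ proj₁) (coeff-𝔖-support α α>0 β)
  where
  below : ∀ β → β <ₗ α → coeff (𝔖 α) β ≡ 0ℚ
  below β β<α = [ id , (λ (_ , β≮α) → contradiction β<α β≮α) ]′ (coeff-𝔖-support α α>0 β)

corollary3p18 : (n : ℕ) →
    ((α : List ℕ) → IsComp n α → Homogeneous n (𝔖 α))
    × ((c : List ℕ → ℚ) → ((β : List ℕ) → coeff (lincomb n c) β ≡ 0ℚ) →
    (α : List ℕ) → IsComp n α → c α ≡ 0ℚ)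
    × ((x : NSym) → Homogeneous n x →
    Σ (List ℕ → ℚ) (λ c → (β : List ℕ) → coeff (lincomb n c) β ≡ coeff x β))
corollary3p18 n = homogeneous , independent , spanning
  where
  sorted : AllPairs _<ₗ_ (comps n)
  sorted = compsF-sorted n n
  family : All (λ α → UnitriangularAt α × SupportedIn (comps n) (coeff (𝔖 α))) (comps n)
  family = All.map 𝔖-unitriangular (compsF-sound n n)

  homogeneous : ∀ α → IsComp n α → Homogeneous n (𝔖 α)
  homogeneous α (α>0 , |α|≡n) β |β|≢n =
    [ id , (λ ((_ , |β|≡|α|) , _) → contradiction (trans |β|≡|α| |α|≡n) |β|≢n) ]′ (coeff-𝔖-support α α>0 β)

  independent : ∀ c → (∀ β → coeff (lincomb n c) β ≡ 0ℚ) → ∀ α → IsComp n α → c α ≡ 0ℚ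
  independent c vanishes α α⊨n = All.lookup
    (combination-independent sorted (All.map proj₁ family) c λ β → trans (sym (coeff-lincomb (comps n) c β)) (vanishes β))
    (comps-complete α⊨n)

  spanning : ∀ x → Homogeneous n x → Σ (List ℕ → ℚ) λ c → ∀ β → coeff (lincomb n c) β ≡ coeff x β
  spanning x hom =
    let c , spans = combination-spanning sorted family (coeff x) (homogeneous-support x hom)
    in  c , λ β → trans (coeff-lincomb (comps n) c β) (spans β)
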